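{- Let $n\ge 5$ and let $\mathbf{u},\mathbf{v}\in\{0,1\}^n$ with $\mathbf{v}$ not a constant vector (i.e. $\mathbf{v}\ne 0^n,1^n$). Suppose $\mathbf{u}$ is $2$-dominant over $\mathbf{v}$ and the Hamming distance $d(\mathbf{u},\mathbf{v})=1$. Then, up to equivalence, there exist $\{p,q\}=\{0,1\}$ and an integer $m\ge 0$ (with all exponents below nonnegative) such that either $\mathbf{u}=p^mqp^{n-m-2}q$ and $\mathbf{v}=p^{n-1}q$, or $\mathbf{u}=p^mqp^{n-m-3}qp$ and $\mathbf{v}=p^{n-2}qp$.
   Context: For a binary vector $\mathbf{u}$ of length $n$, $D_2(\mathbf{u})$ denotes the set of all vectors of length $n-2$ obtained from $\mathbf{u}$ by deleting $2$ entries (all subsequences of length $n-2$). $\mathbf{u}$ is $2$-dominant over $\mathbf{v}$ if $\mathbf{u}\neq\mathbf{v}$ and $D_2(\mathbf{v})\subseteq D_2(\mathbf{u})$. $d(\mathbf{u},\mathbf{v})$ is the Hamming distance (number of coordinates where they differ). For $p\in\{0,1\}$ and $a\ge0$, $p^a$ is the string of $a$ copies of $p$, and juxtaposition denotes concatenation. "Up to equivalence" means up to applying the same one of the following transformations to both $\mathbf{u}$ and $\mathbf{v}$: complementing every entry; reversing the order of the entries; or both (reversal followed by complementation). -}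

module Defs where

open import Data.Bool using (Bool; true; false; not)
open import Data.Nat using (ℕ; zero; suc; _+_; _∸_)
open import Data.List using (List; []; _∷_; length; map; reverse; replicate; _++_; [_])
open import Data.List.Relation.Binary.Sublist.Propositional using (_⊆_)
open import Data.Product using (_×_; Σ; ∃; _,_)
open import Data.Sum using (_⊎_)
open import Relation.Binary.PropositionalEquality using (_≡_; _≢_)

-- Binary words are lists of Booleans (false = 0, true = 1).
Word : Set
Word = List Bool

_∈D₂_ : Word → Word → Set
w ∈D₂ u = (w ⊆ u) × (length w + 2 ≡ length u)

TwoDominant : Word → Word → Set
TwoDominant u v = (u ≢ v) × (∀ w → w ∈D₂ v → w ∈D₂ u)

-- Hamming distance (extra entries of the longer word are ignored; used only
-- on words of equal length).
hamming : Word → Word → ℕ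
hamming []       _        = 0
hamming (_ ∷ _)  []       = 0
hamming (x ∷ xs) (y ∷ ys) with x | y
... | true  | true  = hamming xs ys
... | false | false = hamming xs ys
... | _     | _     = suc (hamming xs ys)

_^_ : Bool → ℕ → Word
p ^ a = replicate a p

complement : Word → Word
complement = map not

-- The four equivalence transformations (applied to both u and v).
data Transform : Set where
  identityT reverseT complementT reverseComplementT : Transform

apply : Transform → Word → Word
apply identityT         w = w
apply reverseT          w = reverse w
apply complementT       w = complement w
apply reverseComplementT w = complement (reverse w)

-- The two canonical forms, for p and q = not p.  The exponent n-m-2
-- (resp. n-m-3) is written as k with m + k + 2 ≡ n (resp. m + k + 3 ≡ n),
-- which encodes that all exponents are nonnegative.
CanonicalForm : ℕ → Word → Word → Set
CanonicalForm n u v = Σ Bool λ p → let q = not p in Σ ℕ λ m → Σ ℕ λ k →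
    ((m + k + 2 ≡ n) × (u ≡ (p ^ m) ++ [ q ] ++ (p ^ k) ++ [ q ])
                     × (v ≡ (p ^ (n ∸ 1)) ++ [ q ]))
  ⊎ ((m + k + 3 ≡ n) × (u ≡ (p ^ m) ++ [ q ] ++ (p ^ k) ++ [ q ] ++ [ p ])
                     × (v ≡ (p ^ (n ∸ 2)) ++ [ q ] ++ [ p ]))

-- Write q = not p.  If u and v differ in a single position, where v has p
-- and u has q, then u has one p fewer than v, so no word of D₂(v) may keep
-- all the p's of v: hence v has at most one q, and (being non-constant)
-- exactly one.  So u = p^c q p^d q p^b, with v obtained by turning one of
-- the two q's back into p; up to reversal it is the first one.  The number
-- of p's after the first q can only decrease when passing to a
-- subsequence; it is d + b in u but d + 1 + b in the word obtained from v
-- by deleting two letters of p^c, so c ≤ 1, which is the claimed form.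
module Submission where

open import Defs
open import Data.Bool using (Bool; true; false; not)
open import Data.Bool.Properties using (_≟_; not-involutive)
open import Data.Empty using (⊥-elim)
open import Data.List using ([]; _∷_; length; reverse; _++_; [_]; filter)
open import Data.List.Properties
  using (length-++; length-replicate; length-reverse; filter-++; ++-assoc;
         reverse-++; unfold-reverse; reverse-involutive)
open import Data.List.Relation.Binary.Sublist.Propositional
  using (_⊆_; []; _∷_; _∷ʳ_; ⊆-refl; ⊆-trans)
open import Data.List.Relation.Binary.Sublist.Propositional.Properties
  using (filter⁺; length-mono-≤; reverse⁺)
open import Data.Nat using (ℕ; zero; suc; _+_; _≤_; _<_; z≤n; s≤s; _≤?_)
open import Data.Nat.Properties using (+-suc; +-comm; +-identityʳ; suc-injective; n≮n; ≰⇒>)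
open import Data.Nat.Tactic.RingSolver using (solve-∀)
open import Data.Product using (_×_; Σ; _,_)
open import Data.Sum using (_⊎_; inj₁; inj₂)
open import Function using (_∘_)
open import Relation.Nullary using (yes; no)
open import Relation.Binary.PropositionalEquality
  using (_≡_; _≢_; refl; sym; trans; cong; cong₂; subst; subst₂; module ≡-Reasoning)

open ≡-Reasoning

infix 4 _⊒_

_⊒_ : Word → Word → Set
u ⊒ v = ∀ w → w ∈D₂ v → w ∈D₂ u

marked : Bool → ℕ → Bool → ℕ → Bool → ℕ → Word
marked p c a d b e = p ^ c ++ a ∷ p ^ d ++ b ∷ p ^ e

count : Bool → Word → ℕ
count b = length ∘ filter (_≟ b)

count-++ : ∀ b xs ys → count b (xs ++ ys) ≡ count b xs + count b ys
count-++ b xs ys = trans (cong length (filter-++ (_≟ b) xs ys)) (length-++ (filter (_≟ b) xs))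

count-mono : ∀ b {w z} → w ⊆ z → count b w ≤ count b z
count-mono b σ = length-mono-≤ (filter⁺ (_≟ b) (_≟ b) (λ { refl x≡b → x≡b }) σ)

count-∷-self : ∀ b xs → count b (b ∷ xs) ≡ suc (count b xs)
count-∷-self true  xs = refl
count-∷-self false xs = refl

count-∷-not : ∀ b xs → count b (not b ∷ xs) ≡ count b xs
count-∷-not true  xs = refl
count-∷-not false xs = refl

count-not-∷ : ∀ b xs → count (not b) (b ∷ xs) ≡ count (not b) xs
count-not-∷ true  xs = refl
count-not-∷ false xs = refl

count-replicate-++ : ∀ p k xs → count p (p ^ k ++ xs) ≡ k + count p xs
count-replicate-++ p zero    xs = refl
count-replicate-++ p (suc k) xs = trans (count-∷-self p _) (cong suc (count-replicate-++ p k xs))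

count-flip : ∀ p x y → count p (x ++ p ∷ y) ≡ suc (count p (x ++ not p ∷ y))
count-flip p x y = begin
  count p (x ++ p ∷ y)            ≡⟨ count-++ p x (p ∷ y) ⟩
  count p x + count p (p ∷ y)     ≡⟨ cong (count p x +_) (count-∷-self p y) ⟩
  count p x + suc (count p y)     ≡⟨ +-suc (count p x) (count p y) ⟩
  suc (count p x + count p y)     ≡⟨ cong (suc ∘ (count p x +_)) (sym (count-∷-not p y)) ⟩
  suc (count p x + count p (not p ∷ y)) ≡⟨ cong suc (sym (count-++ p x (not p ∷ y))) ⟩
  suc (count p (x ++ not p ∷ y))  ∎

count-not≡0 : ∀ p z → count (not p) z ≡ 0 → z ≡ p ^ length z
count-not≡0 p     []           _ = refl
count-not≡0 true  (true ∷ xs)  h = cong (true ∷_) (count-not≡0 true xs h)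
count-not≡0 false (false ∷ xs) h = cong (false ∷_) (count-not≡0 false xs h)

count-not≡1 : ∀ p z → count (not p) z ≡ 1 → Σ ℕ λ c → Σ ℕ λ d → z ≡ p ^ c ++ not p ∷ p ^ d
count-not≡1 true (true ∷ xs) h with count-not≡1 true xs h
... | c , d , refl = suc c , d , refl
count-not≡1 false (false ∷ xs) h with count-not≡1 false xs h
... | c , d , refl = suc c , d , refl
count-not≡1 true  (false ∷ xs) h = 0 , length xs , cong (false ∷_) (count-not≡0 true xs (suc-injective h))
count-not≡1 false (true ∷ xs)  h = 0 , length xs , cong (true ∷_) (count-not≡0 false xs (suc-injective h))

delete-occurrences : ∀ k b z → k ≤ count b z →
  Σ Word λ w → w ⊆ z × length w + k ≡ length z × count (not b) w ≡ count (not b) z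
delete-occurrences zero    b     z        _       = z , ⊆-refl , +-identityʳ (length z) , refl
delete-occurrences (suc k) true  (true ∷ xs) (s≤s h) with delete-occurrences k true xs h
... | w , σ , len , cnt = w , true ∷ʳ σ , trans (+-suc (length w) k) (cong suc len) , cnt
delete-occurrences (suc k) false (false ∷ xs) (s≤s h) with delete-occurrences k false xs h
... | w , σ , len , cnt = w , false ∷ʳ σ , trans (+-suc (length w) k) (cong suc len) , cnt
delete-occurrences (suc k) true  (false ∷ xs) h with delete-occurrences (suc k) true xs h
... | w , σ , len , cnt = false ∷ w , refl ∷ σ , cong suc len , cong suc cnt
delete-occurrences (suc k) false (true ∷ xs) h with delete-occurrences (suc k) false xs h
... | w , σ , len , cnt = true ∷ w , refl ∷ σ , cong suc len , cong suc cnt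

afterFirst : Bool → Word → Word
afterFirst q []       = []
afterFirst q (x ∷ xs) with x ≟ q
... | yes _ = xs
... | no  _ = afterFirst q xs

afterFirst-⊆ : ∀ q xs → afterFirst q xs ⊆ xs
afterFirst-⊆ q []       = []
afterFirst-⊆ q (x ∷ xs) with x ≟ q
... | yes _ = x ∷ʳ ⊆-refl
... | no  _ = x ∷ʳ afterFirst-⊆ q xs

afterFirst-mono : ∀ q {w z} → w ⊆ z → afterFirst q w ⊆ afterFirst q z
afterFirst-mono q [] = []
afterFirst-mono q (y ∷ʳ σ) with y ≟ q
... | yes _ = ⊆-trans (afterFirst-⊆ q _) σ
... | no  _ = afterFirst-mono q σ
afterFirst-mono q (_∷_ {x = x} refl σ) with x ≟ q
... | yes _ = σ
... | no  _ = afterFirst-mono q σ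

afterFirst-replicate-++ : ∀ p c r → afterFirst (not p) (p ^ c ++ not p ∷ r) ≡ r
afterFirst-replicate-++ true  zero    r = refl
afterFirst-replicate-++ false zero    r = refl
afterFirst-replicate-++ true  (suc c) r = afterFirst-replicate-++ true c r
afterFirst-replicate-++ false (suc c) r = afterFirst-replicate-++ false c r

hamming≡0⇒≡ : ∀ u v → length u ≡ length v → hamming u v ≡ 0 → u ≡ v
hamming≡0⇒≡ []           []           _   _ = refl
hamming≡0⇒≡ (true ∷ xs)  (true ∷ ys)  len h = cong (true ∷_) (hamming≡0⇒≡ xs ys (suc-injective len) h)
hamming≡0⇒≡ (false ∷ xs) (false ∷ ys) len h = cong (false ∷_) (hamming≡0⇒≡ xs ys (suc-injective len) h)

hamming≡1⇒flip : ∀ u v → length u ≡ length v → hamming u v ≡ 1 →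
  Σ Bool λ a → Σ Word λ x → Σ Word λ y → u ≡ x ++ not a ∷ y × v ≡ x ++ a ∷ y
hamming≡1⇒flip (true ∷ xs) (true ∷ ys) len h with hamming≡1⇒flip xs ys (suc-injective len) h
... | a , x , y , refl , refl = a , true ∷ x , y , refl , refl
hamming≡1⇒flip (false ∷ xs) (false ∷ ys) len h with hamming≡1⇒flip xs ys (suc-injective len) h
... | a , x , y , refl , refl = a , false ∷ x , y , refl , refl
hamming≡1⇒flip (true ∷ xs) (false ∷ ys) len h =
  false , [] , ys , cong (true ∷_) (hamming≡0⇒≡ xs ys (suc-injective len) (suc-injective h)) , refl
hamming≡1⇒flip (false ∷ xs) (true ∷ ys) len h =
  true , [] , ys , cong (false ∷_) (hamming≡0⇒≡ xs ys (suc-injective len) (suc-injective h)) , refl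

∈D₂-reverse : ∀ {w u} → w ∈D₂ u → reverse w ∈D₂ reverse u
∈D₂-reverse {w} {u} (σ , len) =
  reverse⁺ σ , trans (cong (_+ 2) (length-reverse w)) (trans len (sym (length-reverse u)))

⊒-reverse : ∀ {u v} → u ⊒ v → reverse u ⊒ reverse v
⊒-reverse {u} {v} u⊒v w w∈ =
  subst (_∈D₂ reverse u) (reverse-involutive w)
    (∈D₂-reverse (u⊒v (reverse w) (subst (reverse w ∈D₂_) (reverse-involutive v) (∈D₂-reverse w∈))))

reverse-++-∷ : ∀ (xs : Word) a ys → reverse (xs ++ a ∷ ys) ≡ reverse ys ++ a ∷ reverse xs
reverse-++-∷ xs a ys = begin
  reverse (xs ++ a ∷ ys)              ≡⟨ reverse-++ xs (a ∷ ys) ⟩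
  reverse (a ∷ ys) ++ reverse xs      ≡⟨ cong (_++ reverse xs) (unfold-reverse a ys) ⟩
  (reverse ys ++ [ a ]) ++ reverse xs ≡⟨ ++-assoc (reverse ys) [ a ] (reverse xs) ⟩
  reverse ys ++ a ∷ reverse xs        ∎

replicate-++-∷ : ∀ (p : Bool) c d xs → p ^ c ++ p ∷ p ^ d ++ xs ≡ p ^ suc (c + d) ++ xs
replicate-++-∷ p zero    d xs = refl
replicate-++-∷ p (suc c) d xs = cong (p ∷_) (replicate-++-∷ p c d xs)

replicate-∷ʳ : ∀ (p : Bool) k → p ^ k ++ [ p ] ≡ p ^ suc k
replicate-∷ʳ p zero    = refl
replicate-∷ʳ p (suc k) = cong (p ∷_) (replicate-∷ʳ p k)

reverse-replicate : ∀ (p : Bool) k → reverse (p ^ k) ≡ p ^ k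
reverse-replicate p zero    = refl
reverse-replicate p (suc k) = begin
  reverse (p ^ suc k)      ≡⟨ unfold-reverse p (p ^ k) ⟩
  reverse (p ^ k) ++ [ p ] ≡⟨ cong (_++ [ p ]) (reverse-replicate p k) ⟩
  p ^ k ++ [ p ]           ≡⟨ replicate-∷ʳ p k ⟩
  p ^ suc k                ∎

reverse-marked : ∀ p c a d b e → reverse (marked p c a d b e) ≡ marked p e b d a c
reverse-marked p c a d b e = begin
  reverse (p ^ c ++ a ∷ p ^ d ++ b ∷ p ^ e)
    ≡⟨ reverse-++-∷ (p ^ c) a (p ^ d ++ b ∷ p ^ e) ⟩
  reverse (p ^ d ++ b ∷ p ^ e) ++ a ∷ reverse (p ^ c)
    ≡⟨ cong₂ (λ s t → s ++ a ∷ t) (reverse-++-∷ (p ^ d) b (p ^ e)) (reverse-replicate p c) ⟩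
  (reverse (p ^ e) ++ b ∷ reverse (p ^ d)) ++ a ∷ p ^ c
    ≡⟨ cong₂ (λ s t → (s ++ b ∷ t) ++ a ∷ p ^ c) (reverse-replicate p e) (reverse-replicate p d) ⟩
  (p ^ e ++ b ∷ p ^ d) ++ a ∷ p ^ c
    ≡⟨ ++-assoc (p ^ e) (b ∷ p ^ d) (a ∷ p ^ c) ⟩
  p ^ e ++ b ∷ p ^ d ++ a ∷ p ^ c ∎

length-marked : ∀ p c a d b e → length (marked p c a d b e) ≡ 2 + (e + (c + d))
length-marked p c a d b e = begin
  length (p ^ c ++ a ∷ p ^ d ++ b ∷ p ^ e)
    ≡⟨ length-++ (p ^ c) ⟩
  length (p ^ c) + suc (length (p ^ d ++ b ∷ p ^ e))
    ≡⟨ cong₂ (λ s t → s + suc t) (length-replicate c) (length-++ (p ^ d)) ⟩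
  c + suc (length (p ^ d) + suc (length (p ^ e)))
    ≡⟨ cong₂ (λ s t → c + suc (s + suc t)) (length-replicate d) (length-replicate e) ⟩
  c + suc (d + suc e)
    ≡⟨ rearrange c d e ⟩
  2 + (e + (c + d)) ∎
  where
  rearrange : ∀ c d e → c + suc (d + suc e) ≡ 2 + (e + (c + d))
  rearrange = solve-∀

⊒-flip⇒count-not<2 : ∀ p x y → x ++ not p ∷ y ⊒ x ++ p ∷ y → count (not p) (x ++ p ∷ y) < 2
⊒-flip⇒count-not<2 p x y u⊒v with 2 ≤? count (not p) (x ++ p ∷ y)
... | no  ≱2 = ≰⇒> ≱2
... | yes ≥2 with delete-occurrences 2 (not p) (x ++ p ∷ y) ≥2
...   | w , w⊆v , len , same with u⊒v w (w⊆v , len)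
...     | w⊆u , _ = ⊥-elim (n≮n (count p (x ++ not p ∷ y)) (subst (_≤ _) keeps-p (count-mono p w⊆u)))
  where
  keeps-p : count p w ≡ suc (count p (x ++ not p ∷ y))
  keeps-p = trans (subst (λ b → count b w ≡ count b (x ++ p ∷ y)) (not-involutive p) same)
                  (count-flip p x y)

⊒-flip⇒count-not≡1 : ∀ p x y → x ++ not p ∷ y ⊒ x ++ p ∷ y →
  x ++ p ∷ y ≢ p ^ length (x ++ p ∷ y) → count (not p) (x ++ p ∷ y) ≡ 1
⊒-flip⇒count-not≡1 p x y u⊒v v≢pⁿ
  with count (not p) (x ++ p ∷ y) | ⊒-flip⇒count-not<2 p x y u⊒v | count-not≡0 p (x ++ p ∷ y)
... | 0 | _ | v≡pⁿ = ⊥-elim (v≢pⁿ (v≡pⁿ refl))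
... | 1 | _ | _ = refl
... | suc (suc _) | s≤s (s≤s ()) | _

m+n≡1-cases : ∀ {m n} → m + n ≡ 1 → (m ≡ 1 × n ≡ 0) ⊎ (m ≡ 0 × n ≡ 1)
m+n≡1-cases {0}     n≡1 = inj₂ (refl , n≡1)
m+n≡1-cases {1} {0} _   = inj₁ (refl , refl)

flip-shape : ∀ p x y → count (not p) (x ++ p ∷ y) ≡ 1 → Σ ℕ λ c → Σ ℕ λ d → Σ ℕ λ b →
    (x ++ not p ∷ y ≡ marked p c (not p) d (not p) b × x ++ p ∷ y ≡ marked p c (not p) d p b)
  ⊎ (x ++ not p ∷ y ≡ marked p c (not p) d (not p) b × x ++ p ∷ y ≡ marked p c p d (not p) b)
flip-shape p x y h with m+n≡1-cases (trans (sym split) h)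
  where
  split : count (not p) (x ++ p ∷ y) ≡ count (not p) x + count (not p) y
  split = trans (count-++ (not p) x (p ∷ y)) (cong (count (not p) x +_) (count-not-∷ p y))
... | inj₁ (x-has-one , y-has-none) with count-not≡1 p x x-has-one
...   | c , d , refl = c , d , length y , inj₁ (marks (not p) , marks p)
  where
  marks : ∀ a → (p ^ c ++ not p ∷ p ^ d) ++ a ∷ y ≡ marked p c (not p) d a (length y)
  marks a = trans (++-assoc (p ^ c) (not p ∷ p ^ d) (a ∷ y))
                  (cong (λ t → p ^ c ++ not p ∷ p ^ d ++ a ∷ t) (count-not≡0 p y y-has-none))
flip-shape p x y h | inj₂ (x-has-none , y-has-one) with count-not≡1 p y y-has-one
...   | d , b , refl = length x , d , b , inj₂ (marks (not p) , marks p)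
  where
  marks : ∀ a → x ++ a ∷ p ^ d ++ not p ∷ p ^ b ≡ marked p (length x) a d (not p) b
  marks a = cong (λ t → t ++ a ∷ p ^ d ++ not p ∷ p ^ b) (count-not≡0 p x x-has-none)

⊒-flipSecond⇒prefix≤1 : ∀ p c d b → marked p c (not p) d (not p) b ⊒ marked p c (not p) d p b → c ≤ 1
⊒-flipSecond⇒prefix≤1 p 0             d b _   = z≤n
⊒-flipSecond⇒prefix≤1 p 1             d b _   = s≤s z≤n
⊒-flipSecond⇒prefix≤1 p (suc (suc c)) d b u⊒v with u⊒v w (p ∷ʳ p ∷ʳ ⊆-refl , +-comm (length w) 2)
  where
  w : Word
  w = marked p c (not p) d p b
... | w⊆u , _ = ⊥-elim (n≮n (d + k) (subst₂ _≤_ p-after-q-in-w p-after-q-in-u tails))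
  where
  k : ℕ
  k = count p (p ^ b)
  after-first-q : ∀ c a → count p (afterFirst (not p) (marked p c (not p) d a b)) ≡ d + count p (a ∷ p ^ b)
  after-first-q c a = trans (cong (count p) (afterFirst-replicate-++ p c _)) (count-replicate-++ p d (a ∷ p ^ b))
  p-after-q-in-w : count p (afterFirst (not p) (marked p c (not p) d p b)) ≡ suc (d + k)
  p-after-q-in-w = trans (after-first-q c p) (trans (cong (d +_) (count-∷-self p (p ^ b))) (+-suc d k))
  p-after-q-in-u : count p (afterFirst (not p) (marked p (suc (suc c)) (not p) d (not p) b)) ≡ d + k
  p-after-q-in-u = trans (after-first-q (suc (suc c)) (not p)) (cong (d +_) (count-∷-not p (p ^ b)))
  tails : count p (afterFirst (not p) (marked p c (not p) d p b))
        ≤ count p (afterFirst (not p) (marked p (suc (suc c)) (not p) d (not p) b))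
  tails = count-mono p (afterFirst-mono (not p) w⊆u)

canonical : ∀ p c d b → b ≤ 1 →
  CanonicalForm (length (marked p c (not p) d (not p) b))
                (marked p c (not p) d (not p) b) (marked p c p d (not p) b)
canonical p c d 0 _ rewrite length-marked p c (not p) d (not p) 0 =
  p , c , d , inj₁ (+-comm (c + d) 2 , refl , replicate-++-∷ p c d [ not p ])
canonical p c d 1 _ rewrite length-marked p c (not p) d (not p) 1 =
  p , c , d , inj₂ (+-comm (c + d) 3 , refl , replicate-++-∷ p c d (not p ∷ [ p ]))
canonical p c d (suc (suc _)) (s≤s ())

⊒-flipFirst⇒canonical : ∀ n p c d b {u v} →
  u ≡ marked p c (not p) d (not p) b → v ≡ marked p c p d (not p) b →
  length u ≡ n → u ⊒ v → CanonicalForm n u v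
⊒-flipFirst⇒canonical n p c d b refl refl refl u⊒v = canonical p c d b (⊒-flipSecond⇒prefix≤1 p b d c reversed)
  where
  reversed : marked p b (not p) d (not p) c ⊒ marked p b (not p) d p c
  reversed = subst₂ _⊒_ (reverse-marked p c (not p) d (not p) b) (reverse-marked p c p d (not p) b)
                        (⊒-reverse u⊒v)

nonconstant : ∀ {n} v → length v ≡ n → v ≢ false ^ n → v ≢ true ^ n → ∀ p → v ≢ p ^ length v
nonconstant v refl v≢0ⁿ _    false = v≢0ⁿ
nonconstant v refl _    v≢1ⁿ true  = v≢1ⁿ

proposition3 : (n : ℕ) → 5 ≤ n → (u v : Word) → length u ≡ n → length v ≡ n →
    v ≢ (false ^ n) → v ≢ (true ^ n) →
    TwoDominant u v → hamming u v ≡ 1 →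
    Σ Transform λ T → CanonicalForm n (apply T u) (apply T v)
proposition3 n _ u v lu lv v≢0ⁿ v≢1ⁿ (_ , u⊒v) d≡1 with hamming≡1⇒flip u v (trans lu (sym lv)) d≡1
... | p , x , y , refl , refl
  with flip-shape p x y (⊒-flip⇒count-not≡1 p x y u⊒v (nonconstant v lv v≢0ⁿ v≢1ⁿ p))
... | c , d , b , inj₂ (u≡ , v≡) = identityT , ⊒-flipFirst⇒canonical n p c d b u≡ v≡ lu u⊒v
... | c , d , b , inj₁ (u≡ , v≡) =
  reverseT , ⊒-flipFirst⇒canonical n p b d c
               (trans (cong reverse u≡) (reverse-marked p c (not p) d (not p) b))
               (trans (cong reverse v≡) (reverse-marked p c (not p) d p b))
               (trans (length-reverse u) lu) (⊒-reverse u⊒v)
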